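{- Let $r\geq k\geq 1$, $n,t\geq 1$, and let $\varphi$ be an $(r,k)$-colouring of $K_n$ such that $\mathrm{tc}(K_n,\varphi)=t$ and every vertex sees each colour of $[r]$. Then $k\binom{n}{2}\leq r\left(t-1+\binom{n-2(t-1)}{2}\right)$.
   Context: For integers $r\geq k\geq 1$, an $(r,k)$-colouring of a graph $G$ is a function $\varphi:E(G)\to\binom{[r]}{k}$, assigning to each edge a set of exactly $k$ colours from $[r]=\{1,\dots,r\}$. A vertex sees colour $i$ if it is incident to an edge $e$ with $i\in\varphi(e)$. A subgraph $H\subseteq G$ is monochromatic if there is a colour $i$ belonging to $\varphi(e)$ for every $e\in E(H)$. $\mathrm{tc}(G,\varphi)$ is the minimum number of monochromatic trees (a single vertex counts as a tree) whose union covers $V(G)$. -}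

module Defs where

open import Data.Nat using (ℕ)
open import Data.Fin using (Fin)
open import Data.Fin.Subset using (Subset; _∈_; ∣_∣)
open import Data.List using (List; []; _∷_)
import Data.List.Membership.Propositional as LM
open import Data.Product using (Σ; ∃; _×_)
open import Relation.Binary.PropositionalEquality using (_≡_; _≢_)
open import Relation.Nullary using (¬_)

-- Values on the diagonal are irrelevant.
record Colouring (n r k : ℕ) : Set where
  field
    col  : Fin n → Fin n → Subset r
    sym  : ∀ u v → col u v ≡ col v u
    size : ∀ u v → u ≢ v → ∣ col u v ∣ ≡ k
open Colouring public

data MonoTree {n r k : ℕ} (φ : Colouring n r k) (i : Fin r) : List (Fin n) → Set where
  single : ∀ v → MonoTree φ i (v ∷ [])
  grow   : ∀ {vs} u w → MonoTree φ i vs → u LM.∈ vs → ¬ (w LM.∈ vs)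
         → i ∈ col φ u w → MonoTree φ i (w ∷ vs)

Cover : {n r k : ℕ} → Colouring n r k → ℕ → Set
Cover {n} {r} φ m =
  Σ (Fin m → Fin r) λ c →
  Σ (Fin m → List (Fin n)) λ T →
  (∀ j → MonoTree φ (c j) (T j)) × (∀ v → ∃ λ j → v LM.∈ T j)

TcIs : {n r k : ℕ} → Colouring n r k → ℕ → Set
TcIs φ t = Cover φ t × (∀ m → m Data.Nat.< t → ¬ Cover φ m)

SeesAll : {n r k : ℕ} → Colouring n r k → Set
SeesAll {n} {r} φ = ∀ (v : Fin n) (i : Fin r) → ∃ λ u → u ≢ v × i ∈ col φ v u

-- Fix a colour i and let G be the graph of edges whose colour set contains i. Every vertex
-- sees i, so G has no isolated vertex; spanning trees of the components of G are
-- monochromatic trees covering V(K_n), so G has at least t components. Peeling off t − 1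
-- components, each with at least two vertices, and using convexity of m ↦ m(m − 1), G has at
-- most (t − 1) + C(n − 2(t − 1), 2) edges. Every edge of K_n lies in exactly k of the r
-- graphs, so summing over the colours gives the bound.

module Submission where

open import Defs hiding (sym; size)
open import Data.Nat using (ℕ; zero; suc; _≤_; _<_; _*_; _+_; _∸_; z≤n; s≤s)
open import Data.Nat.Properties hiding (_≟_)
open import Data.Nat.Combinatorics using (_C_; nC1≡n; nCk+nC[k+1]≡[n+1]C[k+1])
open import Data.Nat.Tactic.RingSolver using (solve-∀)
open import Data.Bool using (Bool; true; false; T; _∧_; not)
open import Data.Unit using (tt)
open import Data.Fin using (Fin; zero; suc; _≟_)
open import Data.Fin.Properties using (any?)
open import Data.Fin.Subset using (Subset; ∣_∣) renaming (_∈_ to _∈ₛ_)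
open import Data.Fin.Subset.Properties using () renaming (_∈?_ to _∈ₛ?_)
open import Data.List using (List; []; _∷_)
open import Data.Vec using ([]; _∷_)
open import Data.List.Membership.Propositional using (_∈_; _∉_)
import Data.List.Membership.DecPropositional as DecMembership
open import Data.List.Relation.Unary.Any using (here; there)
open import Data.Product using (Σ; ∃; _×_; _,_)
open import Data.Empty using (⊥-elim)
open import Relation.Nullary using (¬_; Dec; yes; no; does; ¬?; _×-dec_)
open import Relation.Nullary.Decidable using (T?; dec-true; dec-false; decidable-stable)
open import Relation.Binary.PropositionalEquality
open import Algebra.Properties.Semiring.Sum +-*-semiring
  using (sum; sum-syntax; sum-cong-≗; ∑-distrib-+; ∑-comm; *-distribʳ-sum)

𝟙 : Bool → ℕ
𝟙 true  = 1
𝟙 false = 0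

𝟙-T : ∀ {b} → T b → 1 ≤ 𝟙 b
𝟙-T {true} _ = ≤-refl

𝟙-*-mono : ∀ {b m o} → (T b → m ≤ o) → 𝟙 b * m ≤ 𝟙 b * o
𝟙-*-mono {true}  m≤o = +-monoˡ-≤ 0 (m≤o tt)
𝟙-*-mono {false} _   = z≤n

𝟙-not+𝟙 : ∀ b → 𝟙 (not b) + 𝟙 b ≡ 1
𝟙-not+𝟙 true  = refl
𝟙-not+𝟙 false = refl

𝟙-split : ∀ {b c} → (T c → T b) → 𝟙 b ≡ 𝟙 c + 𝟙 (b ∧ not c)
𝟙-split {true}  {true}  _   = refl
𝟙-split {true}  {false} _   = refl
𝟙-split {false} {true}  c⇒b = ⊥-elim (c⇒b tt)
𝟙-split {false} {false} _   = refl

𝟙-not-does-mono : ∀ {a b} {A : Set a} {B : Set b} (a? : Dec A) (b? : Dec B) →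
                  (A → B) → 𝟙 (not (does b?)) ≤ 𝟙 (not (does a?))
𝟙-not-does-mono (yes _) (yes _) _   = z≤n
𝟙-not-does-mono (yes a) (no ¬b) a⇒b = ⊥-elim (¬b (a⇒b a))
𝟙-not-does-mono (no _)  (yes _) _   = z≤n
𝟙-not-does-mono (no _)  (no _)  _   = ≤-refl

T-does : ∀ {a} {A : Set a} (a? : Dec A) → A → T (does a?)
T-does (yes _) _ = tt
T-does (no ¬a) a = ¬a a

T-does⁻ : ∀ {a} {A : Set a} (a? : Dec A) → T (does a?) → A
T-does⁻ (yes a) _ = a

T-∧-not : ∀ {b c} → T b → ¬ T c → T (b ∧ not c)
T-∧-not {true} {true}  _ ¬c = ¬c tt
T-∧-not {true} {false} _ _  = tt

T-∧-not⁻ : ∀ {b c} → T (b ∧ not c) → T b × ¬ T c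
T-∧-not⁻ {true} {false} _ = tt , λ ()

sum-const : ∀ n c → ∑[ i < n ] c ≡ n * c
sum-const zero    c = refl
sum-const (suc n) c = cong (c +_) (sum-const n c)

sum-mono-≤ : ∀ {n} {f g : Fin n → ℕ} → (∀ i → f i ≤ g i) → sum f ≤ sum g
sum-mono-≤ {zero}  _   = z≤n
sum-mono-≤ {suc n} f≤g = +-mono-≤ (f≤g zero) (sum-mono-≤ (λ i → f≤g (suc i)))

sum-mono-< : ∀ {n} {f g : Fin n → ℕ} j → (∀ i → f i ≤ g i) → f j < g j → sum f < sum g
sum-mono-< zero    f≤g fj<gj = +-mono-<-≤ fj<gj (sum-mono-≤ (λ i → f≤g (suc i)))
sum-mono-< (suc j) f≤g fj<gj = +-mono-≤-< (f≤g zero) (sum-mono-< j (λ i → f≤g (suc i)) fj<gj)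

≤-sum : ∀ {n} (f : Fin n → ℕ) j → f j ≤ sum f
≤-sum f zero    = m≤m+n _ _
≤-sum f (suc j) = ≤-trans (≤-sum (λ i → f (suc i)) j) (m≤n+m _ _)

sum-≟ : ∀ {n} (u : Fin n) → ∑[ v < n ] 𝟙 (does (u ≟ v)) ≡ 1
sum-≟ {suc n} zero    = cong suc (trans (sum-const n 0) (*-zeroʳ n))
sum-≟ {suc n} (suc u) = sum-≟ u

sum-≢ : ∀ {n} (u : Fin n) → ∑[ v < n ] 𝟙 (not (does (u ≟ v))) ≡ n ∸ 1
sum-≢ {n} u = begin
  ∑ne                          ≡⟨ m+n∸n≡m ∑ne 1 ⟨
  ∑ne + 1 ∸ 1                  ≡⟨ cong (λ x → ∑ne + x ∸ 1) (sum-≟ u) ⟨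
  ∑ne + sum eq ∸ 1             ≡⟨ cong (_∸ 1) (∑-distrib-+ ne eq) ⟨
  ∑[ v < n ] (ne v + eq v) ∸ 1 ≡⟨ cong (_∸ 1) (sum-cong-≗ (λ v → 𝟙-not+𝟙 (does (u ≟ v)))) ⟩
  ∑[ v < n ] 1 ∸ 1             ≡⟨ cong (_∸ 1) (trans (sum-const n 1) (*-identityʳ n)) ⟩
  n ∸ 1                        ∎
  where
  open ≡-Reasoning
  eq ne : Fin n → ℕ
  eq v = 𝟙 (does (u ≟ v))
  ne v = 𝟙 (not (does (u ≟ v)))
  ∑ne = sum ne

∣p∣≡∑𝟙∈ : ∀ {r} (p : Subset r) → ∣ p ∣ ≡ ∑[ i < r ] 𝟙 (does (i ∈ₛ? p))
∣p∣≡∑𝟙∈ []          = refl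
∣p∣≡∑𝟙∈ (true ∷ p)  = cong suc (∣p∣≡∑𝟙∈ p)
∣p∣≡∑𝟙∈ (false ∷ p) = ∣p∣≡∑𝟙∈ p

2*nC2≡n*[n∸1] : ∀ n → 2 * (n C 2) ≡ n * (n ∸ 1)
2*nC2≡n*[n∸1] zero          = refl
2*nC2≡n*[n∸1] (suc zero)    = refl
2*nC2≡n*[n∸1] (suc (suc n)) = begin
  2 * ((2 + n) C 2)                   ≡⟨ cong (2 *_) (nCk+nC[k+1]≡[n+1]C[k+1] (suc n) 1) ⟨
  2 * ((1 + n) C 1 + (1 + n) C 2)     ≡⟨ cong (λ x → 2 * (x + (1 + n) C 2)) (nC1≡n (suc n)) ⟩
  2 * (1 + n + (1 + n) C 2)           ≡⟨ *-distribˡ-+ 2 (suc n) _ ⟩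
  2 * (1 + n) + 2 * ((1 + n) C 2)     ≡⟨ cong (2 * suc n +_) (2*nC2≡n*[n∸1] (suc n)) ⟩
  2 * (1 + n) + (1 + n) * n           ≡⟨ identity n ⟩
  (2 + n) * (1 + n)                   ∎
  where
  open ≡-Reasoning
  identity : ∀ n → 2 * (1 + n) + (1 + n) * n ≡ (2 + n) * (1 + n)
  identity = solve-∀

-- Convexity: fragments of sizes a and M span at most as many edges as one isolated edge
-- together with a fragment of size a + M − 2.
merge-fragments : ∀ {a M t d e} → 2 ≤ a → 2 ≤ M → d ≤ a * (a ∸ 1) → e ≤ 2 * t + M * (M ∸ 1) →
  ∃ λ M′ → 2 ≤ M′ × a + (2 * t + M) ≡ 2 * suc t + M′ × d + e ≤ 2 * suc t + M′ * (M′ ∸ 1)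
merge-fragments {suc (suc b)} {suc (suc p)} {t} (s≤s (s≤s _)) (s≤s (s≤s _)) d≤ e≤ =
  2 + b + p , s≤s (s≤s z≤n) , size-identity b p t ,
  ≤-trans (+-mono-≤ d≤ e≤) (≤-trans (m≤m+n _ (2 * b * p)) (≤-reflexive (edge-identity b p t)))
  where
  size-identity : ∀ b p t → 2 + b + (2 * t + (2 + p)) ≡ 2 * (1 + t) + (2 + b + p)
  size-identity = solve-∀
  edge-identity : ∀ b p t → (2 + b) * (1 + b) + (2 * t + (2 + p) * (1 + p)) + 2 * b * p
                          ≡ 2 * (1 + t) + (2 + b + p) * (1 + b + p)
  edge-identity = solve-∀

Region : ℕ → Set
Region n = Fin n → Bool

module _ {n : ℕ} where

  open DecMembership (_≟_ {n}) using (_∈?_)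

  card : Region n → ℕ
  card R = ∑[ v < n ] 𝟙 (R v)

  mass : Region n → (Fin n → ℕ) → ℕ
  mass R w = ∑[ v < n ] (𝟙 (R v) * w v)

  _∖_ : Region n → Region n → Region n
  (R ∖ P) v = R v ∧ not (P v)

  ⟦_⟧ : List (Fin n) → Region n
  ⟦ vs ⟧ v = does (v ∈? vs)

  mass-const : ∀ R c → mass R (λ _ → c) ≡ card R * c
  mass-const R c = sym (*-distribʳ-sum c (λ v → 𝟙 (R v)))

  module _ {R P : Region n} (P⊆R : ∀ v → T (P v) → T (R v)) where

    card-∖ : card R ≡ card P + card (R ∖ P)
    card-∖ = trans (sum-cong-≗ (λ v → 𝟙-split (P⊆R v))) (∑-distrib-+ (λ v → 𝟙 (P v)) _)

    mass-∖ : ∀ w → mass R w ≡ mass P w + mass (R ∖ P) w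
    mass-∖ w = trans (sum-cong-≗ split) (∑-distrib-+ (λ v → 𝟙 (P v) * w v) _)
      where
      split : ∀ v → 𝟙 (R v) * w v ≡ 𝟙 (P v) * w v + 𝟙 ((R ∖ P) v) * w v
      split v = trans (cong (_* w v) (𝟙-split (P⊆R v))) (*-distribʳ-+ (w v) (𝟙 (P v)) _)

  outside : List (Fin n) → ℕ
  outside vs = ∑[ v < n ] 𝟙 (not (⟦ vs ⟧ v))

  outside-∷ : ∀ {y vs} → y ∉ vs → outside (y ∷ vs) < outside vs
  outside-∷ {y} {vs} y∉vs = sum-mono-< y (λ v → 𝟙-not-does-mono (v ∈? vs) (v ∈? y ∷ vs) there) y-leaves
    where
    y-leaves : 𝟙 (not (⟦ y ∷ vs ⟧ y)) < 𝟙 (not (⟦ vs ⟧ y))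
    y-leaves rewrite dec-true (y ∈? y ∷ vs) (here refl) | dec-false (y ∈? vs) y∉vs = ≤-refl

module ColourClass {n r k : ℕ} (φ : Colouring n r k) (i : Fin r) where

  open DecMembership (_≟_ {n}) using (_∈?_)

  Adj : Fin n → Fin n → Set
  Adj u v = i ∈ₛ col φ u v

  Adj-sym : ∀ {u v} → Adj u v → Adj v u
  Adj-sym {u} {v} = subst (i ∈ₛ_) (Colouring.sym φ u v)

  NoIsolated : Set
  NoIsolated = ∀ u → ∃ λ w → w ≢ u × Adj u w

  edge : Fin n → Fin n → ℕ
  edge u v with u ≟ v
  ... | yes _ = 0
  ... | no  _ = 𝟙 (does (i ∈ₛ? col φ u v))

  degree : Fin n → ℕ
  degree u = ∑[ v < n ] edge u v

  degreeSum : Region n → ℕ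
  degreeSum R = mass R degree

  Closed : Region n → Set
  Closed R = ∀ {u v} → T (R u) → Adj u v → T (R v)

  CoveredBy : Region n → ℕ → Set
  CoveredBy R m =
    Σ (Fin m → List (Fin n)) λ trees →
    (∀ j → MonoTree φ i (trees j)) × (∀ v → T (R v) → ∃ λ j → v ∈ trees j)

  ∖-closed : ∀ {R P} → Closed R → Closed P → Closed (R ∖ P)
  ∖-closed {R} {P} R-closed P-closed x∈R∖P a with T-∧-not⁻ {R _} {P _} x∈R∖P
  ... | x∈R , x∉P = T-∧-not (R-closed x∈R a) (λ y∈P → x∉P (P-closed y∈P (Adj-sym a)))

  degree+1≤card : ∀ {R u} → Closed R → T (R u) → degree u + 1 ≤ card R
  degree+1≤card {R} {u} R-closed u∈R = begin
    degree u + 1                                   ≡⟨ cong (degree u +_) (sum-≟ u) ⟨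
    degree u + ∑[ v < n ] 𝟙 (does (u ≟ v))         ≡⟨ ∑-distrib-+ (edge u) _ ⟨
    ∑[ v < n ] (edge u v + 𝟙 (does (u ≟ v)))       ≤⟨ sum-mono-≤ edge+δ≤𝟙 ⟩
    card R                                         ∎
    where
    open ≤-Reasoning
    edge+δ≤𝟙 : ∀ v → edge u v + 𝟙 (does (u ≟ v)) ≤ 𝟙 (R v)
    edge+δ≤𝟙 v with u ≟ v
    ... | yes refl = 𝟙-T u∈R
    ... | no  _    with i ∈ₛ? col φ u v
    ...   | yes a = 𝟙-T (R-closed u∈R a)
    ...   | no  _ = z≤n

  degreeSum≤card*[card∸1] : ∀ {R} → Closed R → degreeSum R ≤ card R * (card R ∸ 1)
  degreeSum≤card*[card∸1] {R} R-closed = begin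
    degreeSum R                   ≤⟨ sum-mono-≤ (λ u → 𝟙-*-mono (degree≤card∸1 u)) ⟩
    mass R (λ _ → card R ∸ 1)     ≡⟨ mass-const R (card R ∸ 1) ⟩
    card R * (card R ∸ 1)         ∎
    where
    open ≤-Reasoning
    degree≤card∸1 : ∀ u → T (R u) → degree u ≤ card R ∸ 1
    degree≤card∸1 u u∈R = m+n≤o⇒m≤o∸n (degree u) (degree+1≤card R-closed u∈R)

  1≤degree : NoIsolated → ∀ u → 1 ≤ degree u
  1≤degree no-isolated u with no-isolated u
  ... | w , w≢u , a = ≤-trans 1≤edge (≤-sum (edge u) w)
    where
    1≤edge : 1 ≤ edge u w
    1≤edge with u ≟ w
    ... | yes u≡w = ⊥-elim (w≢u (sym u≡w))
    ... | no  _   rewrite dec-true (i ∈ₛ? col φ u w) a = ≤-refl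

  2≤card : ∀ {R u} → NoIsolated → Closed R → T (R u) → 2 ≤ card R
  2≤card {u = u} no-isolated R-closed u∈R =
    ≤-trans (+-monoˡ-≤ 1 (1≤degree no-isolated u)) (degree+1≤card R-closed u∈R)

  record Component (R : Region n) (u : Fin n) : Set where
    field
      vertices : List (Fin n)
      tree     : MonoTree φ i vertices
      ⊆R       : ∀ {v} → v ∈ vertices → T (R v)
      root     : u ∈ vertices
      closed   : ∀ {x y} → x ∈ vertices → Adj x y → y ∈ vertices

  -- Adds leaves until no edge of colour i leaves the tree; each leaf decreases `outside`.
  grow-component : ∀ {R u} → Closed R → (fuel : ℕ) → ∀ {vs} → outside vs < fuel →
                   MonoTree φ i vs → (∀ {v} → v ∈ vs → T (R v)) → u ∈ vs → Component R u
  grow-component {R} {u} R-closed (suc fuel) {vs} bound tree vs⊆R u∈vs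
    with any? (λ x → (x ∈? vs) ×-dec any? (λ y → ¬? (y ∈? vs) ×-dec (i ∈ₛ? col φ x y)))
  ... | yes (x , x∈vs , y , y∉vs , a) =
    grow-component R-closed fuel (≤-trans (outside-∷ y∉vs) (≤-pred bound))
      (grow x y tree x∈vs y∉vs a) y∷vs⊆R (there u∈vs)
    where
    y∷vs⊆R : ∀ {v} → v ∈ y ∷ vs → T (R v)
    y∷vs⊆R (here refl) = R-closed (vs⊆R x∈vs) a
    y∷vs⊆R (there v∈vs) = vs⊆R v∈vs
  ... | no no-leaf = record
    { vertices = vs ; tree = tree ; ⊆R = vs⊆R ; root = u∈vs
    ; closed = λ {x} {y} x∈vs a → decidable-stable (y ∈? vs) (λ y∉vs → no-leaf (x , x∈vs , y , y∉vs , a))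
    }

  component : ∀ {R u} → Closed R → T (R u) → Component R u
  component {u = u} R-closed u∈R =
    grow-component R-closed (suc (outside (u ∷ []))) ≤-refl (single u) (λ { (here refl) → u∈R }) (here refl)

  module _ {R u} (K : Component R u) where
    open Component K

    ⟦vertices⟧⊆R : ∀ v → T (⟦ vertices ⟧ v) → T (R v)
    ⟦vertices⟧⊆R v v∈K = ⊆R (T-does⁻ (v ∈? vertices) v∈K)

    ⟦vertices⟧-closed : Closed ⟦ vertices ⟧
    ⟦vertices⟧-closed {x} {y} x∈K a = T-does (y ∈? vertices) (closed (T-does⁻ (x ∈? vertices) x∈K) a)

    cover-∷ : ∀ {m} → CoveredBy (R ∖ ⟦ vertices ⟧) m → CoveredBy R (suc m)
    cover-∷ {m} (trees , monochromatic , covers) = trees′ , monochromatic′ , covers′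
      where
      trees′ : Fin (suc m) → List (Fin n)
      trees′ zero    = vertices
      trees′ (suc j) = trees j
      monochromatic′ : ∀ j → MonoTree φ i (trees′ j)
      monochromatic′ zero    = tree
      monochromatic′ (suc j) = monochromatic j
      covers′ : ∀ v → T (R v) → ∃ λ j → v ∈ trees′ j
      covers′ v v∈R with v ∈? vertices
      ... | yes v∈K = zero , v∈K
      ... | no  v∉K with covers v (T-∧-not v∈R (λ v∈K → v∉K (T-does⁻ (v ∈? vertices) v∈K)))
      ...   | j , v∈tree = suc j , v∈tree

  -- R has 2t + M vertices and at most as many edges as t disjoint edges plus a clique on the
  -- remaining M ≥ 2 vertices (degree sums count each edge twice).
  EdgeBound : ℕ → Region n → Set
  EdgeBound t R = ∃ λ M → 2 ≤ M × card R ≡ 2 * t + M × degreeSum R ≤ 2 * t + M * (M ∸ 1)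

  EdgeBound-∷ : ∀ {t R u} → NoIsolated → (K : Component R u) →
                EdgeBound t (R ∖ ⟦ Component.vertices K ⟧) → EdgeBound (suc t) R
  EdgeBound-∷ {t} {R} no-isolated K (M , 2≤M , card≡ , degreeSum≤)
    with merge-fragments
           (2≤card no-isolated (⟦vertices⟧-closed K) (T-does (_ ∈? Component.vertices K) (Component.root K)))
           2≤M (degreeSum≤card*[card∸1] (⟦vertices⟧-closed K)) degreeSum≤
  ... | M′ , 2≤M′ , card≡′ , degreeSum≤′ =
    M′ , 2≤M′ ,
    trans (card-∖ (⟦vertices⟧⊆R K)) (trans (cong (card ⟦ V ⟧ +_) card≡) card≡′) ,
    subst (_≤ 2 * suc t + M′ * (M′ ∸ 1)) (sym (mass-∖ (⟦vertices⟧⊆R K) degree)) degreeSum≤′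
    where V = Component.vertices K

  uncoverable⇒nonempty : ∀ {t R} → (∀ m → m ≤ t → ¬ CoveredBy R m) → ∃ λ u → T (R u)
  uncoverable⇒nonempty {R = R} uncoverable with any? (λ v → T? (R v))
  ... | yes nonempty = nonempty
  ... | no  empty    = ⊥-elim (uncoverable 0 z≤n ((λ ()) , (λ ()) , λ v v∈R → ⊥-elim (empty (v , v∈R))))

  edgeBound : NoIsolated → ∀ t {R} → Closed R → (∀ m → m ≤ t → ¬ CoveredBy R m) → EdgeBound t R
  edgeBound no-isolated zero {R} R-closed uncoverable
    with u , u∈R ← uncoverable⇒nonempty uncoverable =
    card R , 2≤card no-isolated R-closed u∈R , refl , degreeSum≤card*[card∸1] R-closed
  edgeBound no-isolated (suc t) {R} R-closed uncoverable
    with u , u∈R ← uncoverable⇒nonempty uncoverable =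
    EdgeBound-∷ no-isolated K
      (edgeBound no-isolated t (∖-closed R-closed (⟦vertices⟧-closed K)) rest-uncoverable)
    where
    K = component R-closed u∈R
    rest-uncoverable : ∀ m → m ≤ t → ¬ CoveredBy (R ∖ ⟦ Component.vertices K ⟧) m
    rest-uncoverable m m≤t cover = uncoverable (suc m) (s≤s m≤t) (cover-∷ K cover)

  EdgeBound⇒degreeSum≤ : ∀ {t R} → EdgeBound t R → degreeSum R ≤ 2 * (t + (card R ∸ 2 * t) C 2)
  EdgeBound⇒degreeSum≤ {t} (M , _ , card≡ , degreeSum≤)
    rewrite card≡ | m+n∸m≡n (2 * t) M | *-distribˡ-+ 2 t (M C 2) | 2*nC2≡n*[n∸1] M = degreeSum≤

card-⊤ : ∀ n → card {n} (λ _ → true) ≡ n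
card-⊤ n = trans (sum-const n 1) (*-identityʳ n)

module _ {n r k : ℕ} (φ : Colouring n r k) where

  open ColourClass φ using (edge; degree; degreeSum)

  ∑-edge : ∀ u v → ∑[ i < r ] edge i u v ≡ 𝟙 (not (does (u ≟ v))) * k
  ∑-edge u v with u ≟ v
  ... | yes _   = trans (sum-const r 0) (*-zeroʳ r)
  ... | no  u≢v = begin
    ∑[ i < r ] 𝟙 (does (i ∈ₛ? col φ u v)) ≡⟨ ∣p∣≡∑𝟙∈ (col φ u v) ⟨
    ∣ col φ u v ∣                         ≡⟨ Colouring.size φ u v u≢v ⟩
    k                                     ≡⟨ *-identityˡ k ⟨
    1 * k                                 ∎
    where open ≡-Reasoning

  handshake : ∑[ i < r ] degreeSum i (λ _ → true) ≡ k * (n C 2) * 2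
  handshake = begin
    ∑[ i < r ] ∑[ u < n ] (1 * degree i u)
      ≡⟨ sum-cong-≗ {r} (λ i → sum-cong-≗ {n} (λ u → *-identityˡ _)) ⟩
    ∑[ i < r ] ∑[ u < n ] ∑[ v < n ] edge i u v         ≡⟨ ∑-comm (λ i u → degree i u) ⟩
    ∑[ u < n ] ∑[ i < r ] ∑[ v < n ] edge i u v         ≡⟨ sum-cong-≗ (λ u → ∑-comm (λ i v → edge i u v)) ⟩
    ∑[ u < n ] ∑[ v < n ] ∑[ i < r ] edge i u v         ≡⟨ sum-cong-≗ (λ u → sum-cong-≗ (∑-edge u)) ⟩
    ∑[ u < n ] ∑[ v < n ] (𝟙 (not (does (u ≟ v))) * k)
      ≡⟨ sum-cong-≗ {n} (λ u → *-distribʳ-sum k (λ v → 𝟙 (not (does (u ≟ v))))) ⟨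
    ∑[ u < n ] (∑[ v < n ] 𝟙 (not (does (u ≟ v))) * k) ≡⟨ sum-cong-≗ {n} (λ u → cong (_* k) (sum-≢ u)) ⟩
    ∑[ u < n ] ((n ∸ 1) * k)                            ≡⟨ sum-const n _ ⟩
    n * ((n ∸ 1) * k)                                   ≡⟨ *-assoc n (n ∸ 1) k ⟨
    n * (n ∸ 1) * k                                     ≡⟨ cong (_* k) (2*nC2≡n*[n∸1] n) ⟨
    2 * (n C 2) * k                                     ≡⟨ identity (n C 2) k ⟩
    k * (n C 2) * 2                                     ∎
    where
    open ≡-Reasoning
    identity : ∀ c k → 2 * c * k ≡ k * c * 2
    identity = solve-∀

lemma5p1 : (r k n t : ℕ) → 1 ≤ k → k ≤ r → 1 ≤ n → 1 ≤ t →
    (φ : Colouring n r k) → TcIs φ t → SeesAll φ →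
    k * (n C 2) ≤ r * ((t ∸ 1) + ((n ∸ 2 * (t ∸ 1)) C 2))
lemma5p1 r k n zero    _ _ _ () φ _ _
lemma5p1 r k n (suc t) _ _ _ _ φ (_ , minimal) sees-all = *-cancelʳ-≤ _ _ 2 (begin
  k * (n C 2) * 2                    ≡⟨ handshake φ ⟨
  ∑[ i < r ] degreeSum i (λ _ → true) ≤⟨ sum-mono-≤ colour-bound ⟩
  ∑[ i < r ] (2 * B)                  ≡⟨ sum-const r (2 * B) ⟩
  r * (2 * B)                         ≡⟨ identity r B ⟩
  r * B * 2                           ∎)
  where
  open ColourClass φ using (degreeSum; CoveredBy; EdgeBound⇒degreeSum≤; edgeBound)
  open ≤-Reasoning
  B = t + (n ∸ 2 * t) C 2
  identity : ∀ r b → r * (2 * b) ≡ r * b * 2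
  identity = solve-∀
  no-small-cover : ∀ i m → m ≤ t → ¬ CoveredBy i (λ _ → true) m
  no-small-cover i m m≤t (trees , monochromatic , covers) =
    minimal m (s≤s m≤t) ((λ _ → i) , trees , monochromatic , λ v → covers v tt)
  colour-bound : ∀ i → degreeSum i (λ _ → true) ≤ 2 * B
  colour-bound i = subst (λ c → degreeSum i (λ _ → true) ≤ 2 * (t + (c ∸ 2 * t) C 2)) (card-⊤ n)
    (EdgeBound⇒degreeSum≤ i {t} (edgeBound i (λ u → sees-all u i) t (λ _ _ → tt) (no-small-cover i)))
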